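{- Fix $n\geq 3$. Let $L=\{L(v)\}_{v\in V(C_{2n+1})}$ be an assignment of lists of size $3$ to the vertices of the cycle $C_{2n+1}$ with $2n+1$ vertices, such that $\left|\bigcup_{v\in V(C_{2n+1})}L(v)\right|\neq 3$. Then $C_{2n+1}$ is properly $L$-distinguishable.
   Context: A vertex coloring $f$ of a graph $G$ is distinguishing if the only automorphism $\phi$ of $G$ with $f(\phi(v))=f(v)$ for all vertices $v$ is the identity. Given a list assignment $L$ (a finite set $L(v)$ of colors for each vertex $v$), $G$ is properly $L$-distinguishable if there is a proper vertex coloring $f$ of $G$ which is distinguishing and satisfies $f(v)\in L(v)$ for all $v$. -}

module Defs where

open import Data.Nat using (ℕ; suc; _%_; NonZero)
open import Data.Nat.Properties using (_≟_)
open import Data.Fin using (Fin; toℕ)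
open import Data.List using (List; length; concatMap; deduplicate; allFin)
open import Data.List.Membership.Propositional using (_∈_)
open import Data.List.Relation.Unary.Unique.Propositional using (Unique)
open import Data.Product using (_×_)
open import Data.Sum using (_⊎_)
open import Relation.Binary.PropositionalEquality using (_≡_)
open import Relation.Nullary using (¬_)
open import Function.Bundles using (_↔_; Inverse)

Colour : Set
Colour = ℕ

CycleAdj : (m : ℕ) → .{{NonZero m}} → Fin m → Fin m → Set
CycleAdj m i j = (suc (toℕ i) % m ≡ toℕ j) ⊎ (suc (toℕ j) % m ≡ toℕ i)

record Automorphism {m : ℕ} (Adj : Fin m → Fin m → Set) : Set where
  field
    perm     : Fin m ↔ Fin m
    preserve : ∀ u v → Adj u v → Adj (Inverse.to perm u) (Inverse.to perm v)
    reflect  : ∀ u v → Adj (Inverse.to perm u) (Inverse.to perm v) → Adj u v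

open Automorphism public

Proper : {m : ℕ} (Adj : Fin m → Fin m → Set) → (Fin m → Colour) → Set
Proper Adj f = ∀ u v → Adj u v → ¬ (f u ≡ f v)

Distinguishing : {m : ℕ} (Adj : Fin m → Fin m → Set) → (Fin m → Colour) → Set
Distinguishing Adj f =
  (φ : Automorphism Adj) → (∀ v → f (Inverse.to (perm φ) v) ≡ f v) →
  ∀ v → Inverse.to (perm φ) v ≡ v

-- A list assignment: each vertex gets a finite set of colours (a duplicate-free list).
ListAssignment : ℕ → Set
ListAssignment m = Fin m → List Colour

ProperlyLDistinguishable : {m : ℕ} (Adj : Fin m → Fin m → Set) → ListAssignment m → Set
ProperlyLDistinguishable {m} Adj L =
  Σ (Fin m → Colour) λ f → Proper Adj f × Distinguishing Adj f × (∀ v → f v ∈ L v)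
  where open import Data.Product using (Σ)

HasSize : List Colour → ℕ → Set
HasSize xs k = Unique xs × length xs ≡ k

unionSize : {m : ℕ} → ListAssignment m → ℕ
unionSize {m} L = length (deduplicate _≟_ (concatMap L (allFin m)))

{-# OPTIONS --safe #-}
-- Give vertex 0 a colour c ∈ L(0) that is used nowhere else.  Every other vertex keeps at
-- least two colours of its list besides c, and the path 1, …, 2n closed up by an extra
-- edge {1, 2n} is an even cycle; even cycles are 2-choosable, so the path can be coloured
-- properly from these two-element lists with f(1) ≠ f(2n).  A colour-preserving
-- automorphism fixes 0, the only vertex coloured c, hence also its neighbour 1 (the other
-- neighbour 2n has a different colour), and an automorphism of a cycle fixing two adjacent
-- vertices is the identity.
module Submission where

open import Defs
open import Data.Nat using (ℕ; zero; suc; _+_; _*_; _%_; _≤_; _<_; z≤n; s≤s; _≟_)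
open import Data.Nat.Properties
  using (≤-refl; ≤-pred; suc-injective; <⇒≤; ≤∧≢⇒<; m≤n⇒m<n∨m≡n; 1+n≰n; m≢1+n+m; +-suc; *-suc; anyUpTo?)
open import Data.Nat.DivMod using (_mod_; m%n<n; m≤n⇒m%n≡m; n%n≡0)
open import Data.Fin using (Fin; toℕ) renaming (zero to fzero; suc to fsuc)
open import Data.Fin.Properties using (toℕ-injective; toℕ-fromℕ<; toℕ≤pred[n])
open import Data.List using (List; []; _∷_; length)
open import Data.List.Relation.Unary.All using ([]; _∷_)
open import Data.List.Relation.Unary.AllPairs using ([]; _∷_)
open import Data.List.Relation.Unary.Any using (here; there)
open import Data.List.Membership.Propositional using (_∈_)
open import Data.Product using (Σ; _×_; _,_; proj₁; proj₂)
open import Data.Sum using (_⊎_; inj₁; inj₂; [_,_])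
import Data.Sum as Sum
open import Data.Empty using (⊥-elim)
open import Function using (_∘_)
open import Function.Bundles using (Inverse; Injection)
open import Function.Properties.Inverse using (↔⇒↣)
open import Relation.Nullary using (¬_; Dec; yes; no)
open import Relation.Nullary.Decidable using (_⊎-dec_; _×-dec_; ¬?; decidable-stable)
open import Relation.Binary.PropositionalEquality
  using (_≡_; _≢_; refl; sym; trans; cong; subst; module ≡-Reasoning)

member-of-nonempty : ∀ (xs : List Colour) {k} → length xs ≡ suc k → Σ Colour (_∈ xs)
member-of-nonempty (x ∷ _) _ = x , here refl

record TwoAvoiding (c : Colour) (xs : List Colour) : Set where
  constructor twoAvoiding
  field
    first second : Colour
    first≢second : first ≢ second
    first≢c      : first ≢ c
    second≢c     : second ≢ c
    first∈       : first ∈ xs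
    second∈      : second ∈ xs

two-avoiding : ∀ {xs} → HasSize xs 3 → (c : Colour) → TwoAvoiding c xs
two-avoiding {x ∷ y ∷ z ∷ []} ((x≢y ∷ x≢z ∷ []) ∷ (y≢z ∷ []) ∷ [] ∷ [] , refl) c
  with x ≟ c | y ≟ c
... | yes refl | _ =
  twoAvoiding y z y≢z (x≢y ∘ sym) (x≢z ∘ sym) (there (here refl)) (there (there (here refl)))
... | no x≢c | yes refl =
  twoAvoiding x z x≢z x≢c (y≢z ∘ sym) (here refl) (there (there (here refl)))
... | no x≢c | no y≢c =
  twoAvoiding x y x≢y x≢c y≢c (here refl) (there (here refl))

alternating : Colour → Colour → ℕ → Colour
alternating a b zero    = a
alternating a b (suc i) = alternating b a i

alternating-∈ : ∀ a b i → alternating a b i ≡ a ⊎ alternating a b i ≡ b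
alternating-∈ a b zero    = inj₁ refl
alternating-∈ a b (suc i) = Sum.swap (alternating-∈ b a i)

alternating-≢-suc : ∀ {a b} → a ≢ b → ∀ i → alternating a b i ≢ alternating a b (suc i)
alternating-≢-suc a≢b zero    = a≢b
alternating-≢-suc a≢b (suc i) = alternating-≢-suc (a≢b ∘ sym) i

alternating-even : ∀ a b k → alternating a b (2 * k) ≡ a
alternating-even a b zero    = refl
alternating-even a b (suc k) = trans (cong (alternating a b) (*-suc 2 k)) (alternating-even a b k)

module TwoElementLists (P Q : ℕ → Colour) (P≢Q : ∀ i → P i ≢ Q i) where

  Allowed : ℕ → Colour → Set
  Allowed i x = x ≡ P i ⊎ x ≡ Q i

  allowed? : ∀ i x → Dec (Allowed i x)
  allowed? i x = (x ≟ P i) ⊎-dec (x ≟ Q i)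

  other : ℕ → Colour → Colour
  other i y with P i ≟ y
  ... | yes _ = Q i
  ... | no  _ = P i

  other-allowed : ∀ i y → Allowed i (other i y)
  other-allowed i y with P i ≟ y
  ... | yes _ = inj₂ refl
  ... | no  _ = inj₁ refl

  other-≢ : ∀ i y → other i y ≢ y
  other-≢ i y with P i ≟ y
  ... | yes Pi≡y = λ Qi≡y → P≢Q i (trans Pi≡y (sym Qi≡y))
  ... | no  Pi≢y = Pi≢y

  record CycleColouring (N : ℕ) (g : ℕ → Colour) : Set where
    field
      allowed     : ∀ {i} → i ≤ N → Allowed i (g i)
      consecutive : ∀ {i} → i < N → g i ≢ g (suc i)
      closing     : g 0 ≢ g N

  _⊆ᴬ_ : ℕ → ℕ → Set
  i ⊆ᴬ j = Allowed j (P i) × Allowed j (Q i)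

  _⊆ᴬ?_ : ∀ i j → Dec (i ⊆ᴬ j)
  i ⊆ᴬ? j = allowed? j (P i) ×-dec allowed? j (Q i)

  ⊆ᴬ-allowed : ∀ {i j x} → i ⊆ᴬ j → Allowed i x → Allowed j x
  ⊆ᴬ-allowed (Pi∈j , _) (inj₁ refl) = Pi∈j
  ⊆ᴬ-allowed (_ , Qi∈j) (inj₂ refl) = Qi∈j

  ⊆ᴬ-trans : ∀ {i j k} → i ⊆ᴬ j → j ⊆ᴬ k → i ⊆ᴬ k
  ⊆ᴬ-trans (Pi∈j , Qi∈j) j⊆k = ⊆ᴬ-allowed j⊆k Pi∈j , ⊆ᴬ-allowed j⊆k Qi∈j

  ⊆ᴬ⇒⊇ᴬ : ∀ {i j} → i ⊆ᴬ j → j ⊆ᴬ i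
  ⊆ᴬ⇒⊇ᴬ {i} (inj₁ Pi≡Pj , inj₁ Qi≡Pj) = ⊥-elim (P≢Q i (trans Pi≡Pj (sym Qi≡Pj)))
  ⊆ᴬ⇒⊇ᴬ     (inj₁ Pi≡Pj , inj₂ Qi≡Qj) = inj₁ (sym Pi≡Pj) , inj₂ (sym Qi≡Qj)
  ⊆ᴬ⇒⊇ᴬ     (inj₂ Pi≡Qj , inj₁ Qi≡Pj) = inj₂ (sym Qi≡Pj) , inj₁ (sym Pi≡Qj)
  ⊆ᴬ⇒⊇ᴬ {i} (inj₂ Pi≡Qj , inj₂ Qi≡Qj) = ⊥-elim (P≢Q i (trans Pi≡Qj (sym Qi≡Qj)))

  ⊈ᴬ-witness : ∀ {i j} → ¬ (i ⊆ᴬ j) → Σ Colour λ x → Allowed i x × ¬ Allowed j x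
  ⊈ᴬ-witness {i} {j} i⊈j with allowed? j (P i)
  ... | yes Pi∈j = Q i , inj₂ refl , λ Qi∈j → i⊈j (Pi∈j , Qi∈j)
  ... | no  Pi∉j = P i , inj₁ refl , Pi∉j

  -- Restarting with x at j + 1 makes the greedy colouring forget its seed from there on,
  -- while x not being allowed at j keeps the edge {j, j + 1} proper.
  module Restart {j : ℕ} {x : Colour} (x-allowed : Allowed (suc j) x) (x-forbidden : ¬ Allowed j x) where

    greedy : Colour → ℕ → Colour
    greedy y zero = y
    greedy y (suc i) with i ≟ j
    ... | yes _ = x
    ... | no  _ = other (suc i) (greedy y i)

    greedy-allowed : ∀ {y} → Allowed 0 y → ∀ i → Allowed i (greedy y i)
    greedy-allowed y-allowed zero = y-allowed
    greedy-allowed y-allowed (suc i) with i ≟ j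
    ... | yes refl = x-allowed
    ... | no  _    = other-allowed (suc i) _

    greedy-consecutive : ∀ {y} → Allowed 0 y → ∀ i → greedy y i ≢ greedy y (suc i)
    greedy-consecutive y-allowed i with i ≟ j
    ... | yes refl = λ e → x-forbidden (subst (Allowed i) e (greedy-allowed y-allowed i))
    ... | no  _    = other-≢ (suc i) _ ∘ sym

    greedy-seed-irrelevant : ∀ y y′ {i} → j < i → greedy y i ≡ greedy y′ i
    greedy-seed-irrelevant y y′ {suc i} (s≤s j≤i) with i ≟ j
    ... | yes _   = refl
    ... | no  i≢j = cong (other (suc i)) (greedy-seed-irrelevant y y′ (≤∧≢⇒< j≤i (i≢j ∘ sym)))

  restart-colouring : ∀ {N j} → j < N → ¬ (suc j ⊆ᴬ j) → Σ (ℕ → Colour) (CycleColouring N)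
  restart-colouring {N} {j} j<N j+1⊈j with ⊈ᴬ-witness j+1⊈j
  ... | x , x-allowed , x-forbidden = greedy y , record
    { allowed     = λ {i} _ → greedy-allowed y-allowed i
    ; consecutive = λ {i} _ → greedy-consecutive y-allowed i
    ; closing     = λ y≡gN → other-≢ 0 _ (trans y≡gN (greedy-seed-irrelevant y (P 0) j<N))
    }
    where
    open Restart x-allowed x-forbidden
    y : Colour
    y = other 0 (greedy (P 0) N)
    y-allowed : Allowed 0 y
    y-allowed = other-allowed 0 _

  alternating-colouring : ∀ k → (∀ {j} → j < suc (2 * k) → suc j ⊆ᴬ j) →
    CycleColouring (suc (2 * k)) (alternating (P 0) (Q 0))
  alternating-colouring k shrinking = record
    { allowed     = λ {i} i≤N → ⊆ᴬ-allowed (covers i≤N) (alternating-∈ (P 0) (Q 0) i)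
    ; consecutive = λ {i} _ → alternating-≢-suc (P≢Q 0) i
    ; closing     = λ e → P≢Q 0 (trans e (alternating-even (Q 0) (P 0) k))
    }
    where
    covers : ∀ {i} → i ≤ suc (2 * k) → 0 ⊆ᴬ i
    covers {zero}  _   = inj₁ refl , inj₂ refl
    covers {suc i} i<N = ⊆ᴬ-trans (covers (<⇒≤ i<N)) (⊆ᴬ⇒⊇ᴬ (shrinking i<N))

  -- Either some list {P (j + 1), Q (j + 1)} has a colour outside {P j, Q j} and the restarted
  -- greedy colouring works, or all lists equal {P 0, Q 0} and, the cycle being even,
  -- alternating these two colours works.
  even-cycle-choosable : ∀ k → Σ (ℕ → Colour) (CycleColouring (suc (2 * k)))
  even-cycle-choosable k with anyUpTo? (λ j → ¬? (suc j ⊆ᴬ? j)) (suc (2 * k))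
  ... | yes (j , j<N , j+1⊈j) = restart-colouring j<N j+1⊈j
  ... | no  no-gap = _ , alternating-colouring k λ {j} j<N →
          decidable-stable (suc j ⊆ᴬ? j) (λ j+1⊈j → no-gap (j , j<N , j+1⊈j))

module Cycle (N : ℕ) where

  C : Fin (suc N) → Fin (suc N) → Set
  C = CycleAdj (suc N)

  vertex : ℕ → Fin (suc N)
  vertex i = i mod suc N

  toℕ-vertex : ∀ {i} → i ≤ N → toℕ (vertex i) ≡ i
  toℕ-vertex {i} i≤N = trans (toℕ-fromℕ< (m%n<n i (suc N))) (m≤n⇒m%n≡m i≤N)

  vertex-toℕ : ∀ v → vertex (toℕ v) ≡ v
  vertex-toℕ v = toℕ-injective (toℕ-vertex (toℕ≤pred[n] v))

  _↝_ : ℕ → ℕ → Set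
  i ↝ j = j ≡ suc i ⊎ (i ≡ N × j ≡ 0)

  suc-mod⇒↝ : ∀ {i j} → i ≤ N → suc i % suc N ≡ j → i ↝ j
  suc-mod⇒↝ i≤N refl with m≤n⇒m<n∨m≡n i≤N
  ... | inj₁ i<N  = inj₁ (m≤n⇒m%n≡m i<N)
  ... | inj₂ refl = inj₂ (refl , n%n≡0 (suc N))

  adjacent⇒↝ : ∀ {u v} → C u v → toℕ u ↝ toℕ v ⊎ toℕ v ↝ toℕ u
  adjacent⇒↝ {u} {v} = Sum.map (suc-mod⇒↝ (toℕ≤pred[n] u)) (suc-mod⇒↝ (toℕ≤pred[n] v))

  adjacent-suc : ∀ {i} → i < N → C (vertex i) (vertex (suc i))
  adjacent-suc {i} i<N = inj₁ (begin
    suc (toℕ (vertex i)) % suc N ≡⟨ cong (λ k → suc k % suc N) (toℕ-vertex (<⇒≤ i<N)) ⟩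
    suc i % suc N                ≡⟨ m≤n⇒m%n≡m i<N ⟩
    suc i                        ≡⟨ toℕ-vertex i<N ⟨
    toℕ (vertex (suc i))         ∎)
    where open ≡-Reasoning

  proper-if-steps-differ : (F : ℕ → Colour) → (∀ {i} → i < N → F i ≢ F (suc i)) →
    F N ≢ F 0 → Proper C (F ∘ toℕ)
  proper-if-steps-differ F step-differs wrap-differs u v u~v =
    [ ↝-differs (toℕ≤pred[n] v) , (λ v↝u → ↝-differs (toℕ≤pred[n] u) v↝u ∘ sym) ] (adjacent⇒↝ u~v)
    where
    ↝-differs : ∀ {i j} → j ≤ N → i ↝ j → F i ≢ F j
    ↝-differs j≤N (inj₁ refl)         = step-differs j≤N
    ↝-differs _   (inj₂ (refl , refl)) = wrap-differs

  module _ (φ : Automorphism C) where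

    private
      ϕ : Fin (suc N) → Fin (suc N)
      ϕ = Inverse.to (perm φ)

      ϕ-injective : ∀ {u v} → ϕ u ≡ ϕ v → u ≡ v
      ϕ-injective = Injection.injective (↔⇒↣ (perm φ))

    Fixes : ℕ → Set
    Fixes i = toℕ (ϕ (vertex i)) ≡ i

    neighbour-of-fixed : ∀ {i u} → Fixes i → C (vertex i) u → i ↝ toℕ (ϕ u) ⊎ toℕ (ϕ u) ↝ i
    neighbour-of-fixed {u = u} fixes-i =
      subst (λ k → k ↝ toℕ (ϕ u) ⊎ toℕ (ϕ u) ↝ k) fixes-i ∘ adjacent⇒↝ ∘ preserve φ _ u

    fixes-suc-suc : ∀ {i} → suc (suc i) ≤ N → Fixes i → Fixes (suc i) → Fixes (suc (suc i))
    fixes-suc-suc {i} i+2≤N fixes-i fixes-i+1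
      with neighbour-of-fixed fixes-i+1 (adjacent-suc i+2≤N)
    ... | inj₁ (inj₁ e)          = e
    ... | inj₁ (inj₂ (refl , _)) = ⊥-elim (1+n≰n i+2≤N)
    ... | inj₂ (inj₂ (_ , ()))
    ... | inj₂ (inj₁ e)          = ⊥-elim (m≢1+n+m i (begin
      i                          ≡⟨ toℕ-vertex (<⇒≤ (<⇒≤ i+2≤N)) ⟨
      toℕ (vertex i)             ≡⟨ cong toℕ (ϕ-injective (toℕ-injective (trans fixes-i (suc-injective e)))) ⟩
      toℕ (vertex (suc (suc i))) ≡⟨ toℕ-vertex i+2≤N ⟩
      suc (suc i)                ∎))
      where open ≡-Reasoning

    fixes-0-and-1⇒identity : Fixes 0 → Fixes 1 → ∀ v → ϕ v ≡ v
    fixes-0-and-1⇒identity fixes-0 fixes-1 v =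
      toℕ-injective (subst (λ w → toℕ (ϕ w) ≡ toℕ v) (vertex-toℕ v)
                           (proj₁ (fixes-upto (toℕ v) (toℕ≤pred[n] v))))
      where
      fixes-upto : ∀ i → i ≤ N → Fixes i × (suc i ≤ N → Fixes (suc i))
      fixes-upto zero    _     = fixes-0 , λ _ → fixes-1
      fixes-upto (suc i) i+1≤N with fixes-upto i (<⇒≤ i+1≤N)
      ... | fixes-i , fixes-i+1 =
        fixes-i+1 i+1≤N , λ i+2≤N → fixes-suc-suc i+2≤N fixes-i (fixes-i+1 i+1≤N)

  distinguishing-if-root-unique : (F : ℕ → Colour) → 1 ≤ N →
    (∀ {i} → suc i ≤ N → F (suc i) ≢ F 0) → F 1 ≢ F N → Distinguishing C (F ∘ toℕ)
  distinguishing-if-root-unique F 1≤N root-unique F1≢FN φ preserves-colour =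
    fixes-0-and-1⇒identity φ fixes-0 fixes-1
    where
    ϕ : Fin (suc N) → Fin (suc N)
    ϕ = Inverse.to (perm φ)

    fixes-0 : Fixes φ 0
    fixes-0 with toℕ (ϕ (vertex 0)) in e | toℕ≤pred[n] (ϕ (vertex 0))
    ... | zero  | _     = refl
    ... | suc i | i+1≤N = ⊥-elim (root-unique i+1≤N
                              (trans (cong F (sym e)) (preserves-colour (vertex 0))))

    fixes-1 : Fixes φ 1
    fixes-1 with neighbour-of-fixed φ fixes-0 (adjacent-suc 1≤N)
    ... | inj₁ (inj₁ e)          = e
    ... | inj₁ (inj₂ (refl , _)) = ⊥-elim (1+n≰n 1≤N)
    ... | inj₂ (inj₁ ())
    ... | inj₂ (inj₂ (e , _))    = ⊥-elim (F1≢FN (begin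
      F 1                        ≡⟨ cong F (toℕ-vertex 1≤N) ⟨
      F (toℕ (vertex 1))         ≡⟨ preserves-colour (vertex 1) ⟨
      F (toℕ (ϕ (vertex 1)))     ≡⟨ cong F e ⟩
      F N                        ∎))
      where open ≡-Reasoning

-- Index i of the two-element lists stands for vertex i + 1; vertex 0 alone gets the colour c.
module AvoidingRoot {M : ℕ} (L : ListAssignment (suc (suc M))) (size₃ : ∀ v → HasSize (L v) 3) where

  open Cycle (suc M)

  c : Colour
  c = proj₁ (member-of-nonempty (L fzero) (proj₂ (size₃ fzero)))

  c∈L₀ : c ∈ L fzero
  c∈L₀ = proj₂ (member-of-nonempty (L fzero) (proj₂ (size₃ fzero)))

  avoiding : ∀ i → TwoAvoiding c (L (vertex (suc i)))
  avoiding i = two-avoiding (size₃ (vertex (suc i))) c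

  open TwoAvoiding
  open TwoElementLists (λ i → first (avoiding i)) (λ i → second (avoiding i))
                 (λ i → first≢second (avoiding i)) public

  allowed⇒≢c : ∀ i {x} → Allowed i x → x ≢ c
  allowed⇒≢c i (inj₁ refl) = first≢c (avoiding i)
  allowed⇒≢c i (inj₂ refl) = second≢c (avoiding i)

  allowed⇒∈L : ∀ i {x} → Allowed i x → x ∈ L (vertex (suc i))
  allowed⇒∈L i (inj₁ refl) = first∈ (avoiding i)
  allowed⇒∈L i (inj₂ refl) = second∈ (avoiding i)

  properly-distinguishing : ∀ {g} → CycleColouring M g →
    ProperlyLDistinguishable (CycleAdj (suc (suc M))) L
  properly-distinguishing {g} colouring =
    F ∘ toℕ ,
    proper-if-steps-differ F step-differs (allowed⇒≢c M (allowed ≤-refl)) ,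
    distinguishing-if-root-unique F (s≤s z≤n) (λ {i} i+1≤N → allowed⇒≢c i (allowed (≤-pred i+1≤N))) closing ,
    in-lists
    where
    open CycleColouring colouring

    F : ℕ → Colour
    F zero    = c
    F (suc i) = g i

    step-differs : ∀ {i} → i < suc M → F i ≢ F (suc i)
    step-differs {zero}  _         = allowed⇒≢c 0 (allowed z≤n) ∘ sym
    step-differs {suc i} (s≤s i<M) = consecutive i<M

    in-lists : ∀ v → F (toℕ v) ∈ L v
    in-lists fzero    = c∈L₀
    in-lists (fsuc w) = subst (λ u → g (toℕ w) ∈ L u) (vertex-toℕ (fsuc w))
                              (allowed⇒∈L (toℕ w) (allowed (toℕ≤pred[n] w)))

proposition2p4 : (n : ℕ) → 3 ≤ n → (L : ListAssignment (suc (2 * n))) →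
    (∀ v → HasSize (L v) 3) → ¬ (unionSize L ≡ 3) →
    ProperlyLDistinguishable (CycleAdj (suc (2 * n))) L
proposition2p4 zero    ()
proposition2p4 (suc k) _ L size₃ _ =
  properly-distinguishing (proj₂ (subst (λ M → Σ (ℕ → Colour) (CycleColouring M))
                                        (sym (+-suc k (k + 0))) (even-cycle-choosable k)))
  where open AvoidingRoot L size₃
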